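{- Let $p$ be a nonempty binary word of length $l$ all of whose runs have size at least $2$. Then $p$ has an internal zero at $n$ for every $n \ge l+1$.
   Context: A binary word is a finite sequence over $\{0,1\}$. An occurrence of $p = p_1\cdots p_l$ in $w = w_1\cdots w_n$ is a choice of indices $1 \le i_1 < \cdots < i_l \le n$ with $w_{i_1}\cdots w_{i_l} = p$; $c_p(w)$ is the number of occurrences, and $B_{n,p}(k)$ is the number of binary words $w$ of length $n$ with $c_p(w)=k$. A run is a maximal block of consecutive equal letters; its size is its length. The word $p$ has an internal zero at $n$ if there exist $0 \le k_1 < k_2 < k_3$ with $B_{n,p}(k_1) \ne 0$, $B_{n,p}(k_3) \ne 0$ and $B_{n,p}(k_2) = 0$. -}

module Defs where

open import Data.Bool using (Bool; true; false; if_then_else_)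
open import Data.Bool.Properties using () renaming (_≟_ to _≟B_)
open import Data.Nat using (ℕ; zero; suc; _+_; _≤_; _<_)
open import Data.Nat.Properties using (_≟_)
open import Data.List using (List; []; _∷_; length; filter; map; _++_)
open import Data.List.Relation.Unary.All using (All)
open import Data.Product using (Σ; _×_; ∃; ∃-syntax)
open import Relation.Nullary using (¬_; does)
open import Relation.Binary.PropositionalEquality using (_≡_; _≢_)

-- Binary words: lists over Bool (false = 0, true = 1).
Word : Set
Word = List Bool

-- c p w : number of occurrences of p in w as a (scattered) subword, i.e. the
-- number of index choices i₁ < ⋯ < iₗ with w_{i₁}⋯w_{iₗ} = p.
-- Standard recursion: either the first letter of w is not used, or it is
-- matched with the first letter of p.
c : Word → Word → ℕ
c [] w = 1
c (x ∷ p) [] = 0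
c (x ∷ p) (y ∷ w) = c (x ∷ p) w + (if does (x ≟B y) then c p w else 0)

words : ℕ → List Word
words zero = [] ∷ []
words (suc n) = map (false ∷_) (words n) ++ map (true ∷_) (words n)

B : ℕ → Word → ℕ → ℕ
B n p k = length (filter (λ w → c p w ≟ k) (words n))

runsAux : Bool → ℕ → Word → List ℕ
runsAux b m [] = m ∷ []
runsAux b m (x ∷ w) = if does (x ≟B b) then runsAux b (suc m) w else m ∷ runsAux x 1 w

runs : Word → List ℕ
runs [] = []
runs (x ∷ w) = runsAux x 1 w

InternalZero : Word → ℕ → Set
InternalZero p n = ∃[ k₁ ] ∃[ k₂ ] ∃[ k₃ ]
  (k₁ < k₂ × k₂ < k₃ × B n p k₁ ≢ 0 × B n p k₃ ≢ 0 × B n p k₂ ≡ 0)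

-- Call p two-free if no word contains exactly two occurrences of p. The empty word is
-- two-free, and prefixing a two-free word q with a run x^m, m ≥ 2, keeps it two-free; by induction on
-- the runs, p is two-free, so B n p 2 = 0. On the other hand B n p 0 ≠ 0 (take the word avoiding the
-- first letter of p), and B n p k ≠ 0 for some k > 2: if p = x p′, the word x p contains p at least
-- twice, hence (being two-free) at least three times, and for n ≥ l + 1 it can be padded to length n.
module Submission where

open import Defs
open import Data.Bool using (Bool; true; false; not)
open import Data.Bool.Properties using () renaming (_≟_ to _≟B_)
open import Data.Empty using (⊥-elim)
open import Data.List using ([]; _∷_; length; _++_; replicate; map)
open import Data.List.Properties using (length-++; length-replicate; filter-none)
open import Data.List.Relation.Unary.All using (All; []; _∷_; universal)
open import Data.List.Relation.Unary.Any using (here; there)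
open import Data.List.Membership.Propositional using (_∈_)
open import Data.List.Membership.Propositional.Properties using (∈-filter⁺; ∈-map⁺; ∈-++⁺ˡ; ∈-++⁺ʳ)
open import Data.Nat using (ℕ; zero; suc; _+_; _∸_; _≤_; _<_; z≤n; s≤s)
open import Data.Nat.Properties
  using (_≟_; ≤-refl; ≤-trans; m≤m+n; m≤n+m; +-mono-≤; +-identityʳ; m∸n+n≡m; ≤∧≢⇒<; m+n≡0⇒n≡0)
open import Data.Product using (_,_)
open import Relation.Nullary using (yes; no)
open import Relation.Binary.PropositionalEquality using (_≡_; _≢_; refl; sym; trans; cong; subst; ≢-sym)
open Relation.Binary.PropositionalEquality.≡-Reasoning

c-∷-≡ : ∀ x p w → c (x ∷ p) (x ∷ w) ≡ c (x ∷ p) w + c p w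
c-∷-≡ true  p w = refl
c-∷-≡ false p w = refl

c-∷-≢ : ∀ {x y} p w → x ≢ y → c (x ∷ p) (y ∷ w) ≡ c (x ∷ p) w
c-∷-≢ {true}  {true}  p w x≢y = ⊥-elim (x≢y refl)
c-∷-≢ {true}  {false} p w _   = +-identityʳ _
c-∷-≢ {false} {true}  p w _   = +-identityʳ _
c-∷-≢ {false} {false} p w x≢y = ⊥-elim (x≢y refl)

c-mono-∷ : ∀ p y w → c p w ≤ c p (y ∷ w)
c-mono-∷ []      y w = ≤-refl
c-mono-∷ (x ∷ p) y w = m≤m+n _ _

c-mono-++ : ∀ p u v → c p v ≤ c p (u ++ v)
c-mono-++ p []      v = ≤-refl
c-mono-++ p (y ∷ u) v = ≤-trans (c-mono-++ p u v) (c-mono-∷ p y (u ++ v))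

c-self : ∀ p → 1 ≤ c p p
c-self []      = s≤s z≤n
c-self (x ∷ p) = subst (1 ≤_) (sym (c-∷-≡ x p p)) (≤-trans (c-self p) (m≤n+m _ _))

c-∷-self : ∀ x p → 2 ≤ c (x ∷ p) (x ∷ x ∷ p)
c-∷-self x p = subst (2 ≤_) (sym (c-∷-≡ x p (x ∷ p)))
  (+-mono-≤ (c-self (x ∷ p)) (≤-trans (c-self p) (c-mono-∷ p x p)))

c-tail-pos : ∀ x p w → 1 ≤ c (x ∷ p) w → 1 ≤ c p w
c-tail-pos x p []      ()
c-tail-pos x p (y ∷ w) h with x ≟B y
... | no _ = ≤-trans (c-tail-pos x p w (subst (1 ≤_) (+-identityʳ _) h)) (c-mono-∷ p y w)
... | yes refl = ≤-trans (split (c (x ∷ p) w) refl h) (c-mono-∷ p x w)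
  where
  split : ∀ a → a ≡ c (x ∷ p) w → 1 ≤ a + c p w → 1 ≤ c p w
  split zero    _ h′ = h′
  split (suc a) e _  = c-tail-pos x p w (subst (1 ≤_) e (s≤s z≤n))

c-replicate-not : ∀ x p n → c (x ∷ p) (replicate n (not x)) ≡ 0
c-replicate-not x p zero    = refl
c-replicate-not x p (suc n) = trans (c-∷-≢ p _ (x≢not x)) (c-replicate-not x p n)
  where
  x≢not : ∀ x → x ≢ not x
  x≢not true  ()
  x≢not false ()

+≢2 : ∀ a b → a ≢ 2 → (1 ≤ a → 2 ≤ b) → (a ≡ 0 → b ≢ 2) → a + b ≢ 2
+≢2 0 b             _   _   b≢2 = b≢2 refl
+≢2 1 0             _   _   _   = λ ()
+≢2 1 1             _   b≥2 _ with b≥2 (s≤s z≤n)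
... | s≤s ()
+≢2 1 (suc (suc b)) _   _   _   = λ ()
+≢2 2 0             a≢2 _   _   = a≢2
+≢2 2 (suc b)       _   _   _   = λ ()
+≢2 (suc (suc (suc a))) b _ _ _ = λ ()

+≥2 : ∀ a b d → (1 ≤ a → 2 ≤ b) → (1 ≤ b → 1 ≤ d) → 1 ≤ a + b → 2 ≤ b + d
+≥2 (suc a) b       d b≥2 _   _ = ≤-trans (b≥2 (s≤s z≤n)) (m≤m+n _ _)
+≥2 zero    (suc b) d _   d≥1 _ = +-mono-≤ (s≤s (z≤n {b})) (d≥1 (s≤s z≤n))

-- Read with a j = c (xʲ q) w: these three properties survive prefixing w by a letter.
record AvoidsTwo (a : ℕ → ℕ) : Set where
  field
    ≢2      : ∀ j → a (2 + j) ≢ 2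
    pos⇒≥2  : ∀ j → 1 ≤ a (2 + j) → 2 ≤ a (1 + j)
    zero⇒≢2 : a 2 ≡ 0 → a 1 ≢ 2

AvoidsTwo-cong : ∀ {a b} → (∀ j → a (suc j) ≡ b (suc j)) → AvoidsTwo a → AvoidsTwo b
AvoidsTwo-cong {a} {b} a≗b inv = record
  { ≢2      = λ j → subst (_≢ 2) (a≗b (1 + j)) (≢2 j)
  ; pos⇒≥2  = λ j h → subst (2 ≤_) (a≗b j) (pos⇒≥2 j (subst (1 ≤_) (sym (a≗b (1 + j))) h))
  ; zero⇒≢2 = λ b2≡0 → subst (_≢ 2) (a≗b 0) (zero⇒≢2 (trans (a≗b 1) b2≡0))
  }
  where open AvoidsTwo inv

AvoidsTwo-pascal : ∀ {a b} → (∀ j → b (suc j) ≡ a (suc j) + a j) →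
  a 0 ≢ 2 → (1 ≤ a 1 → 1 ≤ a 0) → AvoidsTwo a → AvoidsTwo b
AvoidsTwo-pascal {a} {b} pascal a0≢2 a1⇒a0 inv = record
  { ≢2      = λ j → subst (_≢ 2) (sym (pascal (1 + j)))
                    (+≢2 _ _ (≢2 j) (pos⇒≥2 j) (zero⇒below j))
  ; pos⇒≥2  = λ j h → subst (2 ≤_) (sym (pascal j))
                    (+≥2 _ _ _ (pos⇒≥2 j) (below-pos j) (subst (1 ≤_) (pascal (1 + j)) h))
  ; zero⇒≢2 = λ b2≡0 → let a1≡0 = m+n≡0⇒n≡0 (a 2) (trans (sym (pascal 1)) b2≡0) in
      subst (_≢ 2) (sym (trans (pascal 0) (cong (_+ a 0) a1≡0))) a0≢2
  }
  where
  open AvoidsTwo inv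
  zero⇒below : ∀ j → a (2 + j) ≡ 0 → a (1 + j) ≢ 2
  zero⇒below zero    = zero⇒≢2
  zero⇒below (suc j) = λ _ → ≢2 j
  below-pos : ∀ j → 1 ≤ a (1 + j) → 1 ≤ a j
  below-pos zero    = a1⇒a0
  below-pos (suc j) = λ h → ≤-trans (s≤s z≤n) (pos⇒≥2 j h)

TwoFree : Word → Set
TwoFree p = ∀ w → c p w ≢ 2

module _ (x : Bool) {q : Word} (q-twoFree : TwoFree q) where

  private
    occ : Word → ℕ → ℕ
    occ w j = c (replicate j x ++ q) w

  avoidsTwo : ∀ w → AvoidsTwo (occ w)
  avoidsTwo [] = record { ≢2 = λ _ (); pos⇒≥2 = λ _ (); zero⇒≢2 = λ _ () }
  avoidsTwo (y ∷ w) with x ≟B y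
  ... | yes refl = AvoidsTwo-pascal (λ j → c-∷-≡ x (replicate j x ++ q) w)
                     (q-twoFree w) (c-tail-pos x q w) (avoidsTwo w)
  ... | no x≢y   = AvoidsTwo-cong (λ j → sym (c-∷-≢ (replicate j x ++ q) w x≢y)) (avoidsTwo w)

  twoFree-replicate-++ : ∀ j → TwoFree (replicate (2 + j) x ++ q)
  twoFree-replicate-++ j w = AvoidsTwo.≢2 (avoidsTwo w) j

-- runsAux b m w lists the run sizes of the word bᵐ w.
twoFree-runsAux : ∀ b m w → All (2 ≤_) (runsAux b m w) → TwoFree (replicate m b ++ w)
twoFree-runsAux b m (y ∷ w) h with y ≟B b
... | yes refl = subst TwoFree (replicate-suc-++ m) (twoFree-runsAux b (suc m) w h)
  where
  replicate-suc-++ : ∀ m → replicate (suc m) b ++ w ≡ replicate m b ++ (b ∷ w)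
  replicate-suc-++ zero    = refl
  replicate-suc-++ (suc m) = cong (b ∷_) (replicate-suc-++ m)
twoFree-runsAux b (suc (suc j)) (y ∷ w) (s≤s (s≤s z≤n) ∷ h) | no _ =
  twoFree-replicate-++ b (twoFree-runsAux y 1 w h) j
twoFree-runsAux b (suc (suc j)) [] _ = twoFree-replicate-++ b (λ _ ()) j
twoFree-runsAux b zero          [] (() ∷ _)
twoFree-runsAux b (suc zero)    [] (s≤s () ∷ _)

twoFree-runs : ∀ p → All (2 ≤_) (runs p) → TwoFree p
twoFree-runs []      _ = λ _ ()
twoFree-runs (x ∷ p) h = twoFree-runsAux x 1 p h

∈-words : ∀ w → w ∈ words (length w)
∈-words []          = here refl
∈-words (false ∷ w) = ∈-++⁺ˡ (∈-map⁺ (false ∷_) (∈-words w))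
∈-words (true  ∷ w) = ∈-++⁺ʳ (map (false ∷_) (words (length w))) (∈-map⁺ (true ∷_) (∈-words w))

B≢0 : ∀ p w {n k} → length w ≡ n → c p w ≡ k → B n p k ≢ 0
B≢0 p w refl refl = length≢0 (∈-filter⁺ (λ v → c p v ≟ c p w) (∈-words w) refl)
  where
  length≢0 : ∀ {v : Word} {vs} → v ∈ vs → length vs ≢ 0
  length≢0 (here _)  ()
  length≢0 (there _) ()

B≡0 : ∀ n p k → (∀ w → c p w ≢ k) → B n p k ≡ 0
B≡0 n p k c≢k = cong length (filter-none (λ w → c p w ≟ k) (universal c≢k (words n)))

mainTheorem9 : (p : Word) → p ≢ [] → All (λ r → 2 ≤ r) (runs p) →
    (n : ℕ) → suc (length p) ≤ n → InternalZero p n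
mainTheorem9 []       p≢[] _      _ _   = ⊥-elim (p≢[] refl)
mainTheorem9 (x ∷ p′) _    runs≥2 n l<n =
  0 , 2 , c p padded , s≤s z≤n , 2<c ,
  B≢0 p (replicate n (not x)) (length-replicate n) (c-replicate-not x p′ n) ,
  B≢0 p padded padded-length refl ,
  B≡0 n p 2 twoFree
  where
  p : Word
  p = x ∷ p′
  twoFree : TwoFree p
  twoFree = twoFree-runs p runs≥2

  m : ℕ
  m = n ∸ suc (length p)
  padded : Word
  padded = replicate m x ++ x ∷ p
  padded-length : length padded ≡ n
  padded-length = begin
    length padded                           ≡⟨ length-++ (replicate m x) ⟩
    length (replicate m x) + suc (length p) ≡⟨ cong (_+ suc (length p)) (length-replicate m) ⟩
    m + suc (length p)                      ≡⟨ m∸n+n≡m l<n ⟩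
    n                                       ∎

  2<c : 2 < c p padded
  2<c = ≤∧≢⇒< (≤-trans (c-∷-self x p′) (c-mono-++ p (replicate m x) (x ∷ p))) (≢-sym (twoFree padded))
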